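{- Let $k\in\mathbb{N}$ and let $\Phi_k$ be any function from the set of graphs with vertex set $\{1,\dots,k\}$ to $\mathbb{Q}$ that is invariant under isomorphism. Then there are coefficients $a_H\in\mathbb{Q}$, $H\in\mathcal{G}_k^*$, such that for every graph $G$ with vertex set $\{1,\dots,k\}$, \[\Phi_k(G)=\sum_{H\in\mathcal{G}_k^*}a_H\cdot\#\mathrm{Sub}(H,G).\] Further, $a_H=(-1)^{|E(H)|}\cdot\mathrm{ae}_{\Phi}(H)$.
   Context: Graphs are finite, simple, undirected. $\mathcal{G}_k^*$ is a set of graphs with vertex set $\{1,\dots,k\}$ containing exactly one representative of each isomorphism class of $k$-vertex graphs. $\mathrm{Sub}(H,G)$ is the set of subgraphs of $G$ isomorphic to $H$. The alternating enumerator is $\mathrm{ae}_\Phi(H)=\sum_{S\subseteq E(H)}\Phi_k((V(H),S))(-1)^{|S|}$. -}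

module Defs where

open import Data.Bool using (Bool; true; false; if_then_else_)
open import Data.Bool.Properties using () renaming (_≟_ to _≟B_)
open import Data.Nat using (ℕ; zero; suc; _<?_)
import Data.Nat as ℕ
open import Data.Integer using (+_)
open import Data.Rational using (ℚ; 0ℚ; 1ℚ; _+_; _*_; -_; _/_)
open import Data.Fin using (Fin; toℕ)
open import Data.Fin.Properties using (any?; all?) renaming (_≟_ to _≟F_)
open import Data.Vec using (Vec; []; _∷_; lookup)
open import Data.List using (List; []; _∷_; [_]; map; concatMap; length; filter; foldr; allFin; cartesianProduct)
open import Data.List.Relation.Unary.Any using (Any)
open import Data.List.Relation.Unary.AllPairs using (AllPairs)
open import Data.Product using (Σ; ∃; _×_; _,_; proj₁; proj₂)
open import Relation.Binary.PropositionalEquality using (_≡_)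
open import Relation.Nullary using (Dec; yes; no; ¬_)
open import Relation.Nullary.Decidable using (_×-dec_; _→-dec_)
open import Relation.Unary using (Pred; Decidable)
open import Level using (Level)

-- Graphs with vertex set {1,…,k}, represented as Fin k.
-- A graph is a symmetric, irreflexive k×k Boolean adjacency matrix.

Matrix : ℕ → Set
Matrix k = Vec (Vec Bool k) k

entry : {k : ℕ} → Matrix k → Fin k → Fin k → Bool
entry A i j = lookup (lookup A i) j

IsGraph : {k : ℕ} → Matrix k → Set
IsGraph {k} A = (∀ (i j : Fin k) → entry A i j ≡ entry A j i) × (∀ (i : Fin k) → entry A i i ≡ false)

isGraph? : {k : ℕ} (A : Matrix k) → Dec (IsGraph A)
isGraph? A = all? (λ i → all? (λ j → entry A i j ≟B entry A j i)) ×-dec all? (λ i → entry A i i ≟B false)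

Graph : ℕ → Set
Graph k = Σ (Matrix k) IsGraph

adj : {k : ℕ} → Graph k → Fin k → Fin k → Bool
adj G = entry (proj₁ G)

-- Isomorphism: a bijection π of the vertex set (given by its table of
-- values, injective hence bijective on Fin k) preserving adjacency.

Iso : {k : ℕ} → Graph k → Graph k → Set
Iso {k} G H = Σ (Vec (Fin k) k) λ π →
  (∀ (i j : Fin k) → lookup π i ≡ lookup π j → i ≡ j) ×
  (∀ (i j : Fin k) → adj G i j ≡ adj H (lookup π i) (lookup π j))

exVec? : {ℓ : Level} {m : ℕ} (n : ℕ) {P : Pred (Vec (Fin m) n) ℓ} → Decidable P → Dec (∃ P)
exVec? zero P? with P? []
... | yes p = yes ([] , p)
... | no ¬p = no λ { ([] , p) → ¬p p }
exVec? (suc n) {P} P? with any? (λ x → exVec? n {λ v → P (x ∷ v)} (λ v → P? (x ∷ v)))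
... | yes (x , v , p) = yes (x ∷ v , p)
... | no ¬p = no λ { (x ∷ v , p) → ¬p (x , v , p) }

iso? : {k : ℕ} (G H : Graph k) → Dec (Iso G H)
iso? {k} G H = exVec? k (λ π →
  all? (λ i → all? (λ j → (lookup π i ≟F lookup π j) →-dec (i ≟F j))) ×-dec
  all? (λ i → all? (λ j → adj G i j ≟B adj H (lookup π i) (lookup π j))))

allVecs : {A : Set} → List A → (n : ℕ) → List (Vec A n)
allVecs xs zero = [ [] ]
allVecs xs (suc n) = concatMap (λ x → map (x ∷_) (allVecs xs n)) xs

allMatrices : (k : ℕ) → List (Matrix k)
allMatrices k = allVecs (allVecs (false ∷ true ∷ []) k) k

_⊆G_ : {k : ℕ} → Matrix k → Graph k → Set
_⊆G_ {k} S G = ∀ (i j : Fin k) → entry S i j ≡ true → adj G i j ≡ true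

⊆G? : {k : ℕ} (S : Matrix k) (G : Graph k) → Dec (S ⊆G G)
⊆G? S G = all? (λ i → all? (λ j → (entry S i j ≟B true) →-dec (adj G i j ≟B true)))

subgraphsFrom : {k : ℕ} → Graph k → List (Matrix k) → List (Graph k)
subgraphsFrom G [] = []
subgraphsFrom G (A ∷ As) with isGraph? A | ⊆G? A G
... | yes p | yes _ = (A , p) ∷ subgraphsFrom G As
... | _     | _     = subgraphsFrom G As

-- the graphs (V(G), S) for S ⊆ E(G), each listed exactly once
subgraphs : {k : ℕ} → Graph k → List (Graph k)
subgraphs {k} G = subgraphsFrom G (allMatrices k)

Sub : {k : ℕ} → Graph k → Graph k → List (Graph k)
Sub H G = filter (λ S → iso? S H) (subgraphs G)

#Sub : {k : ℕ} → Graph k → Graph k → ℕ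
#Sub H G = length (Sub H G)

ltPairs : (k : ℕ) → List (Fin k × Fin k)
ltPairs k = filter (λ p → toℕ (proj₁ p) <? toℕ (proj₂ p)) (cartesianProduct (allFin k) (allFin k))

#E : {k : ℕ} → Graph k → ℕ
#E {k} G = length (filter (λ p → adj G (proj₁ p) (proj₂ p) ≟B true) (ltPairs k))

sumℚ : List ℚ → ℚ
sumℚ = foldr _+_ 0ℚ

sign : ℕ → ℚ
sign zero = 1ℚ
sign (suc n) = - sign n

ℕtoℚ : ℕ → ℚ
ℕtoℚ n = + n / 1

ae : {k : ℕ} → (Graph k → ℚ) → Graph k → ℚ
ae Φ H = sumℚ (map (λ S → Φ S * sign (#E S)) (subgraphs H))

IsoInvariant : {k : ℕ} → (Graph k → ℚ) → Set
IsoInvariant {k} Φ = ∀ (G H : Graph k) → Iso G H → Φ G ≡ Φ H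

IsRepSystem : {k : ℕ} → List (Graph k) → Set
IsRepSystem {k} reps = (∀ (G : Graph k) → Any (Iso G) reps) × AllPairs (λ H H′ → ¬ Iso H H′) reps

-- Put a_H = (-1)^|E(H)| ae_Φ(H); it is isomorphism invariant, since relabelling the vertices
-- permutes the spanning subgraphs and preserves edge counts. Grouping the spanning subgraphs S
-- of G by isomorphism class turns Σ_H a_H #Sub(H,G) into Σ_{S ⊆ G} a_S, and expanding ae_Φ and
-- exchanging the sums gives
--   Σ_{T ⊆ G} Φ(T) (-1)^|E(T)| Σ_{T ⊆ S ⊆ G} (-1)^|E(S)|.
-- The inner sum is (-1)^|E(G)| if T = G and 0 otherwise, because toggling an edge of G missing
-- from T is a sign-reversing involution on the graphs between T and G. What remains is Φ(G).

module Submission where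

open import Defs
open import Algebra.Bundles using (CommutativeSemigroup)
open import Algebra.Core using (Op₂)
open import Algebra.Structures using (IsCommutativeMonoid)
open import Data.Bool using (Bool; true; false; not; _∧_; _xor_; if_then_else_)
open import Data.Bool.Properties using (xor-assoc; xor-same) renaming (_≟_ to _≟B_)
open import Data.Fin using (Fin; toℕ; punchOut; _<_)
open import Data.Fin.Properties using (all?; any?)
import Data.Fin.Properties as Fin
import Data.Integer as ℤ
import Data.Integer.Properties as ℤ
open import Data.List
  using (List; []; _∷_; _++_; map; concatMap; foldr; filter; length; allFin; cartesianProduct; cartesianProductWith)
open import Data.List.Membership.Propositional using (_∈_)
open import Data.List.Membership.Propositional.Properties
  using (∈-map⁺; ∈-filter⁺; ∈-filter⁻; ∈-allFin; ∈-cartesianProduct⁺; ∈-cartesianProductWith⁺)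
open import Data.List.Membership.Propositional.Properties.WithK using (unique∧set⇒bag)
open import Data.List.Properties using (map-∘)
open import Data.List.Relation.Binary.BagAndSetEquality using (∼bag⇒↭)
open import Data.List.Relation.Binary.Permutation.Propositional using (_↭_; refl; prep; swap; trans)
open import Data.List.Relation.Unary.All as All using (All)
open import Data.List.Relation.Unary.AllPairs using (AllPairs)
open import Data.List.Relation.Unary.Any as Any using (Any; here; there)
open import Data.List.Relation.Unary.Unique.Propositional using (Unique; []; _∷_)
import Data.List.Relation.Unary.Unique.Propositional.Properties as Unique
open import Data.Nat using (ℕ; zero; suc; _<?_)
import Data.Nat as ℕ
import Data.Nat.Coprimality as Coprime
import Data.Nat.Properties as ℕ
open import Data.Product as Product using (Σ; ∃; ∃₂; _×_; _,_; proj₁; proj₂; uncurry)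
import Data.Product.Properties as Product
open import Data.Rational using (ℚ; 0ℚ; 1ℚ; ½; _+_; _*_; -_; _/_)
import Data.Rational.Properties as ℚ
open import Data.Sum as Sum using (_⊎_; inj₁; inj₂)
open import Data.Vec using (Vec; []; _∷_; lookup; tabulate)
import Data.Vec.Properties as Vec
open import Function using (id; _∘_; _⇔_; Injective; StrictlyInverseˡ; StrictlyInverseʳ; mk⇔)
open import Level using (0ℓ)
open import Relation.Binary.Definitions using (DecidableEquality; tri<; tri≈; tri>)
open import Relation.Binary.PropositionalEquality as ≡ using (_≡_; _≢_; cong; cong₂; sym; module ≡-Reasoning)
open import Relation.Nullary using (Dec; does; yes; no; ¬_; contradiction)
open import Relation.Nullary.Decidable using (_→-dec_; _×-dec_; _⊎-dec_; dec-true; dec-false; does-⇔)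
open import Relation.Unary using (Pred; Decidable)

open import Algebra.Properties.Ring ℚ.+-*-ring using (-‿involutive; -‿distribˡ-*; -‿distribʳ-*)

module ListSum {C : Set} {_∙_ : Op₂ C} {ε : C} (isCM : IsCommutativeMonoid _≡_ _∙_ ε) where

  open IsCommutativeMonoid isCM using (identityˡ; identityʳ; isCommutativeSemigroup)

  private
    commutativeSemigroup : CommutativeSemigroup 0ℓ 0ℓ
    commutativeSemigroup = record { isCommutativeSemigroup = isCommutativeSemigroup }

  open import Algebra.Properties.CommutativeSemigroup commutativeSemigroup using (interchange; x∙yz≈y∙xz)

  ∑ : {A : Set} → List A → (A → C) → C
  ∑ xs f = foldr _∙_ ε (map f xs)

  when : Bool → C → C
  when b x = if b then x else ε

  when-ε : ∀ b → when b ε ≡ ε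
  when-ε true  = ≡.refl
  when-ε false = ≡.refl

  module _ {A : Set} where

    ∑-cong : (xs : List A) {f g : A → C} → (∀ {x} → x ∈ xs → f x ≡ g x) → ∑ xs f ≡ ∑ xs g
    ∑-cong []       f≗g = ≡.refl
    ∑-cong (x ∷ xs) f≗g = cong₂ _∙_ (f≗g (here ≡.refl)) (∑-cong xs (f≗g ∘ there))

    ∑-zero : (xs : List A) {f : A → C} → (∀ {x} → x ∈ xs → f x ≡ ε) → ∑ xs f ≡ ε
    ∑-zero []       f≗ε = ≡.refl
    ∑-zero (x ∷ xs) f≗ε = ≡.trans (cong₂ _∙_ (f≗ε (here ≡.refl)) (∑-zero xs (f≗ε ∘ there))) (identityˡ ε)

    ∑-distrib : (xs : List A) (f g : A → C) → ∑ xs (λ x → f x ∙ g x) ≡ ∑ xs f ∙ ∑ xs g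
    ∑-distrib []       f g = sym (identityˡ ε)
    ∑-distrib (x ∷ xs) f g = ≡.trans (cong ((f x ∙ g x) ∙_) (∑-distrib xs f g)) (interchange _ _ _ _)

    ∑-filter : ∀ {p} {P : Pred A p} (P? : Decidable P) (xs : List A) (f : A → C) →
               ∑ (filter P? xs) f ≡ ∑ xs (λ x → when (does (P? x)) (f x))
    ∑-filter P? []       f = ≡.refl
    ∑-filter P? (x ∷ xs) f with P? x
    ... | yes _ = cong (f x ∙_) (∑-filter P? xs f)
    ... | no  _ = ≡.trans (∑-filter P? xs f) (sym (identityˡ _))

    ∑-↭ : {xs ys : List A} (f : A → C) → xs ↭ ys → ∑ xs f ≡ ∑ ys f
    ∑-↭ f refl                = ≡.refl
    ∑-↭ f (prep x xs↭ys)      = cong (f x ∙_) (∑-↭ f xs↭ys)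
    ∑-↭ f (swap x y xs↭ys)    = ≡.trans (cong (λ s → f x ∙ (f y ∙ s)) (∑-↭ f xs↭ys)) (x∙yz≈y∙xz _ _ _)
    ∑-↭ f (trans xs↭ys ys↭zs) = ≡.trans (∑-↭ f xs↭ys) (∑-↭ f ys↭zs)

    ∑-reindex : (xs : List A) (f : A → C) (σ τ : A → A) →
                StrictlyInverseˡ _≡_ σ τ → StrictlyInverseʳ _≡_ σ τ →
                Unique xs → (∀ x → x ∈ xs) → ∑ xs (f ∘ σ) ≡ ∑ xs f
    ∑-reindex xs f σ τ στ τσ !xs xs-complete = begin
      ∑ xs (f ∘ σ)    ≡⟨ cong (foldr _∙_ ε) (map-∘ xs) ⟩
      ∑ (map σ xs) f  ≡⟨ ∑-↭ f (∼bag⇒↭ (unique∧set⇒bag (Unique.map⁺ σ-injective !xs) !xs same-elements)) ⟩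
      ∑ xs f          ∎
      where
      open ≡-Reasoning
      σ-injective : Injective _≡_ _≡_ σ
      σ-injective {x} {y} σx≡σy = ≡.trans (sym (τσ x)) (≡.trans (cong τ σx≡σy) (τσ y))
      same-elements : ∀ {x} → (x ∈ map σ xs) ⇔ (x ∈ xs)
      same-elements {x} = mk⇔ (λ _ → xs-complete x) (λ _ → ≡.subst (_∈ map σ xs) (στ x) (∈-map⁺ σ (xs-complete (τ x))))

    ∑-delta : (xs : List A) (f : A → C) {a : A} → Unique xs → a ∈ xs →
              (∀ {x} → x ∈ xs → x ≢ a → f x ≡ ε) → ∑ xs f ≡ f a
    ∑-delta (x ∷ xs) f (x∉xs ∷ !xs) (here ≡.refl) f≗ε =
      ≡.trans (cong (f x ∙_) (∑-zero xs (λ x′∈xs → f≗ε (there x′∈xs) (All.lookup x∉xs x′∈xs ∘ sym)))) (identityʳ _)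
    ∑-delta (x ∷ xs) f (x∉xs ∷ !xs) (there a∈xs) f≗ε =
      ≡.trans (cong₂ _∙_ (f≗ε (here ≡.refl) λ { ≡.refl → All.lookup x∉xs a∈xs ≡.refl })
                         (∑-delta xs f !xs a∈xs (f≗ε ∘ there)))
              (identityˡ _)

    ∑-change-at : (xs : List A) (f g : A → C) {a : A} → Unique xs → a ∈ xs → f a ≡ ε →
                  (∀ {x} → x ∈ xs → x ≢ a → g x ≡ f x) → ∑ xs g ≡ g a ∙ ∑ xs f
    ∑-change-at (x ∷ xs) f g (x∉xs ∷ !xs) (here ≡.refl) fa≡ε g≗f = begin
      g x ∙ ∑ xs g       ≡⟨ cong (g x ∙_) (∑-cong xs (λ x′∈xs → g≗f (there x′∈xs) (All.lookup x∉xs x′∈xs ∘ sym))) ⟩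
      g x ∙ ∑ xs f       ≡⟨ cong (g x ∙_) (sym (identityˡ _)) ⟩
      g x ∙ (ε ∙ ∑ xs f) ≡⟨ cong (λ e → g x ∙ (e ∙ ∑ xs f)) (sym fa≡ε) ⟩
      g x ∙ (f x ∙ ∑ xs f) ∎
      where open ≡-Reasoning
    ∑-change-at (x ∷ xs) f g {a} (x∉xs ∷ !xs) (there a∈xs) fa≡ε g≗f = begin
      g x ∙ ∑ xs g               ≡⟨ cong₂ _∙_ (g≗f (here ≡.refl) λ { ≡.refl → All.lookup x∉xs a∈xs ≡.refl })
                                              (∑-change-at xs f g !xs a∈xs fa≡ε (g≗f ∘ there)) ⟩
      f x ∙ (g a ∙ ∑ xs f)       ≡⟨ x∙yz≈y∙xz _ _ _ ⟩
      g a ∙ (f x ∙ ∑ xs f)       ∎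
      where open ≡-Reasoning

  ∑-comm : {A B : Set} (xs : List A) (ys : List B) (f : A → B → C) →
           ∑ xs (λ x → ∑ ys (f x)) ≡ ∑ ys (λ y → ∑ xs (λ x → f x y))
  ∑-comm []       ys f = sym (∑-zero ys λ _ → ≡.refl)
  ∑-comm (x ∷ xs) ys f = ≡.trans (cong (∑ ys (f x) ∙_) (∑-comm xs ys f))
                                 (sym (∑-distrib ys (f x) λ y → ∑ xs (λ x′ → f x′ y)))

  when-∑ : {A : Set} (c : Bool) (xs : List A) (f : A → C) → when c (∑ xs f) ≡ ∑ xs (when c ∘ f)
  when-∑ true  xs f = ≡.refl
  when-∑ false xs f = sym (∑-zero xs λ _ → ≡.refl)

open ListSum ℚ.+-0-isCommutativeMonoid
module ℕ∑ = ListSum ℕ.+-0-isCommutativeMonoid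

-- Once ℕtoℚ n is rewritten to its normal form mkℚ (+ n) 0 _, the sum 1ℚ + ℕtoℚ n is
-- literally (+ 1 * + 1 + + n * + 1) / 1.
ℕtoℚ-suc : ∀ n → ℕtoℚ (suc n) ≡ 1ℚ + ℕtoℚ n
ℕtoℚ-suc n = begin
  ℤ.+ suc n / 1                              ≡⟨ cong (λ m → (ℤ.+ 1 ℤ.+ m) / 1) (sym (ℤ.*-identityʳ (ℤ.+ n))) ⟩
  (ℤ.+ 1 ℤ.* ℤ.+ 1 ℤ.+ ℤ.+ n ℤ.* ℤ.+ 1) / 1  ≡⟨ cong (1ℚ +_) (sym (ℚ.normalize-coprime (Coprime.sym (Coprime.1-coprimeTo n)))) ⟩
  1ℚ + ℕtoℚ n                                ∎
  where open ≡-Reasoning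

module _ {A : Set} where

  ∑-*ˡ : (c : ℚ) (xs : List A) (f : A → ℚ) → c * ∑ xs f ≡ ∑ xs (λ x → c * f x)
  ∑-*ˡ c []       f = ℚ.*-zeroʳ c
  ∑-*ˡ c (x ∷ xs) f = ≡.trans (ℚ.*-distribˡ-+ c (f x) _) (cong ((c * f x) +_) (∑-*ˡ c xs f))

  ∑-neg : (xs : List A) (f : A → ℚ) → - ∑ xs f ≡ ∑ xs (λ x → - f x)
  ∑-neg []       f = ≡.refl
  ∑-neg (x ∷ xs) f = ≡.trans (ℚ.neg-distrib-+ (f x) _) (cong ((- f x) +_) (∑-neg xs f))

  *-ℕtoℚ-length : (c : ℚ) (xs : List A) → c * ℕtoℚ (length xs) ≡ ∑ xs (λ _ → c)
  *-ℕtoℚ-length c []       = ℚ.*-zeroʳ c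
  *-ℕtoℚ-length c (x ∷ xs) = begin
    c * ℕtoℚ (suc (length xs))    ≡⟨ cong (c *_) (ℕtoℚ-suc (length xs)) ⟩
    c * (1ℚ + ℕtoℚ (length xs))   ≡⟨ ℚ.*-distribˡ-+ c 1ℚ _ ⟩
    c * 1ℚ + c * ℕtoℚ (length xs) ≡⟨ cong₂ _+_ (ℚ.*-identityʳ c) (*-ℕtoℚ-length c xs) ⟩
    c + ∑ xs (λ _ → c)            ∎
    where open ≡-Reasoning

  *-ℕtoℚ-count : ∀ {p} {P : Pred A p} (P? : Decidable P) (c : ℚ) (xs : List A) →
                 c * ℕtoℚ (length (filter P? xs)) ≡ ∑ xs (λ x → when (does (P? x)) c)
  *-ℕtoℚ-count P? c xs = ≡.trans (*-ℕtoℚ-length c (filter P? xs)) (∑-filter P? xs λ _ → c)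

when-neg : (c : Bool) (x : ℚ) → when c (- x) ≡ - when c x
when-neg true  x = ≡.refl
when-neg false x = ≡.refl

when-*-when : (x z : Bool) (s e : ℚ) → when z (s * when x e) ≡ e * when (x ∧ z) s
when-*-when true  true  s e = ℚ.*-comm s e
when-*-when false true  s e = ≡.trans (ℚ.*-zeroʳ s) (sym (ℚ.*-zeroʳ e))
when-*-when true  false s e = sym (ℚ.*-zeroʳ e)
when-*-when false false s e = sym (ℚ.*-zeroʳ e)

x≡-x⇒x≡0 : ∀ x → x ≡ - x → x ≡ 0ℚ
x≡-x⇒x≡0 x x≡-x = begin
  x                     ≡⟨ sym (ℚ.*-identityˡ x) ⟩
  (½ * (1ℚ + 1ℚ)) * x   ≡⟨ ℚ.*-assoc ½ (1ℚ + 1ℚ) x ⟩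
  ½ * ((1ℚ + 1ℚ) * x)   ≡⟨ cong (½ *_) (ℚ.*-distribʳ-+ x 1ℚ 1ℚ) ⟩
  ½ * (1ℚ * x + 1ℚ * x) ≡⟨ cong (λ y → ½ * (y + y)) (ℚ.*-identityˡ x) ⟩
  ½ * (x + x)           ≡⟨ cong (λ y → ½ * (x + y)) x≡-x ⟩
  ½ * (x + - x)         ≡⟨ cong (½ *_) (ℚ.+-inverseʳ x) ⟩
  ½ * 0ℚ                ≡⟨ ℚ.*-zeroʳ ½ ⟩
  0ℚ                    ∎
  where open ≡-Reasoning

sign-*-sign : ∀ n → sign n * sign n ≡ 1ℚ
sign-*-sign zero    = ≡.refl
sign-*-sign (suc n) = begin
  - sign n * - sign n   ≡⟨ sym (-‿distribˡ-* (sign n) (- sign n)) ⟩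
  - (sign n * - sign n) ≡⟨ cong -_ (sym (-‿distribʳ-* (sign n) (sign n))) ⟩
  - - (sign n * sign n) ≡⟨ -‿involutive _ ⟩
  sign n * sign n       ≡⟨ sign-*-sign n ⟩
  1ℚ                    ∎
  where open ≡-Reasoning

concatMap-map≡cartesianProductWith : {A B C : Set} (f : A → B → C) (xs : List A) (ys : List B) →
                                     concatMap (λ x → map (f x) ys) xs ≡ cartesianProductWith f xs ys
concatMap-map≡cartesianProductWith f []       ys = ≡.refl
concatMap-map≡cartesianProductWith f (x ∷ xs) ys = cong (map (f x) ys ++_) (concatMap-map≡cartesianProductWith f xs ys)

allVecs-≡-cartesianProductWith : {A : Set} (xs : List A) (n : ℕ) →
                                 allVecs xs (suc n) ≡ cartesianProductWith _∷_ xs (allVecs xs n)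
allVecs-≡-cartesianProductWith xs n = concatMap-map≡cartesianProductWith _∷_ xs (allVecs xs n)

∈-allVecs : {A : Set} {xs : List A} → (∀ x → x ∈ xs) → {n : ℕ} (v : Vec A n) → v ∈ allVecs xs n
∈-allVecs xs-complete []                          = here ≡.refl
∈-allVecs {xs = xs} xs-complete {suc n} (x ∷ v) = ≡.subst (x ∷ v ∈_) (sym (allVecs-≡-cartesianProductWith xs n))
  (∈-cartesianProductWith⁺ _∷_ (xs-complete x) (∈-allVecs xs-complete v))

allVecs-unique : {A : Set} {xs : List A} → Unique xs → (n : ℕ) → Unique (allVecs xs n)
allVecs-unique !xs zero                  = All.[] ∷ []
allVecs-unique {xs = xs} !xs (suc n) = ≡.subst Unique (sym (allVecs-≡-cartesianProductWith xs n))
  (Unique.cartesianProductWith⁺ _∷_ Vec.∷-injective !xs (allVecs-unique !xs n))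

∈-allMatrices : {k : ℕ} (A : Matrix k) → A ∈ allMatrices k
∈-allMatrices = ∈-allVecs (∈-allVecs λ { false → here ≡.refl ; true → there (here ≡.refl) })

allMatrices-unique : (k : ℕ) → Unique (allMatrices k)
allMatrices-unique k = allVecs-unique (allVecs-unique (((λ ()) All.∷ All.[]) ∷ All.[] ∷ []) k) k

module _ {k : ℕ} where

  pairs : List (Fin k × Fin k)
  pairs = cartesianProduct (allFin k) (allFin k)

  ∈-pairs : (p : Fin k × Fin k) → p ∈ pairs
  ∈-pairs (i , j) = ∈-cartesianProduct⁺ (∈-allFin i) (∈-allFin j)

  pairs-unique : Unique pairs
  pairs-unique = Unique.cartesianProduct⁺ (Unique.allFin⁺ k) (Unique.allFin⁺ k)

-- Relabelling vertices

module _ {k : ℕ} where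

  matrix : (Fin k → Fin k → Bool) → Matrix k
  matrix f = tabulate (λ i → tabulate (f i))

  entry-matrix : (f : Fin k → Fin k → Bool) (i j : Fin k) → entry (matrix f) i j ≡ f i j
  entry-matrix f i j = ≡.trans (cong (λ row → lookup row j) (Vec.lookup∘tabulate _ i)) (Vec.lookup∘tabulate (f i) j)

  matrix-ext : {A B : Matrix k} → (∀ i j → entry A i j ≡ entry B i j) → A ≡ B
  matrix-ext {A} {B} A≗B = begin
    A                                           ≡⟨ sym (Vec.tabulate∘lookup A) ⟩
    tabulate (λ i → lookup A i)                 ≡⟨ Vec.tabulate-cong (λ i → sym (Vec.tabulate∘lookup (lookup A i))) ⟩
    tabulate (λ i → tabulate (entry A i))       ≡⟨ Vec.tabulate-cong (λ i → Vec.tabulate-cong (A≗B i)) ⟩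
    tabulate (λ i → tabulate (entry B i))       ≡⟨ Vec.tabulate-cong (λ i → Vec.tabulate∘lookup (lookup B i)) ⟩
    tabulate (λ i → lookup B i)                 ≡⟨ Vec.tabulate∘lookup B ⟩
    B                                           ∎
    where open ≡-Reasoning

  pull : (Fin k → Fin k) → Matrix k → Matrix k
  pull f A = matrix (λ i j → entry A (f i) (f j))

  entry-pull : (f : Fin k → Fin k) (A : Matrix k) (i j : Fin k) → entry (pull f A) i j ≡ entry A (f i) (f j)
  entry-pull f A = entry-matrix _

  pull-inverse : {f g : Fin k → Fin k} → (∀ i → f (g i) ≡ i) → (A : Matrix k) → pull g (pull f A) ≡ A
  pull-inverse {f} {g} fg A = matrix-ext λ i j → begin
    entry (pull g (pull f A)) i j ≡⟨ entry-pull g (pull f A) i j ⟩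
    entry (pull f A) (g i) (g j)  ≡⟨ entry-pull f A (g i) (g j) ⟩
    entry A (f (g i)) (f (g j))   ≡⟨ cong₂ (entry A) (fg i) (fg j) ⟩
    entry A i j                   ∎
    where open ≡-Reasoning

  IsGraph-pull : (f : Fin k → Fin k) (A : Matrix k) → IsGraph A → IsGraph (pull f A)
  IsGraph-pull f A (symmetric , irreflexive) =
    (λ i j → ≡.trans (entry-pull f A i j) (≡.trans (symmetric _ _) (sym (entry-pull f A j i)))) ,
    (λ i → ≡.trans (entry-pull f A i i) (irreflexive (f i)))

injective⇒surjective : {k : ℕ} {f : Fin k → Fin k} → Injective _≡_ _≡_ f → ∀ y → ∃ λ x → f x ≡ y
injective⇒surjective {suc m} {f} f-injective y with Fin.any? (λ x → f x Fin.≟ y)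
... | yes hit = hit
... | no miss =
  let i , j , i<j , same = Fin.pigeonhole (ℕ.n<1+n m) (λ x → punchOut (miss ∘ (x ,_) ∘ sym))
  in contradiction (f-injective (Fin.punchOut-injective (miss ∘ (i ,_) ∘ sym) (miss ∘ (j ,_) ∘ sym) same))
                   (Fin.<⇒≢ i<j)

module _ {k : ℕ} where

  mkIso : {G H : Graph k} (f : Fin k → Fin k) → Injective _≡_ _≡_ f →
          (∀ i j → adj G i j ≡ adj H (f i) (f j)) → Iso G H
  mkIso {G} {H} f f-injective preserves = tabulate f ,
    (λ i j eq → f-injective (≡.trans (sym (Vec.lookup∘tabulate f i)) (≡.trans eq (Vec.lookup∘tabulate f j)))) ,
    (λ i j → ≡.trans (preserves i j) (cong₂ (adj H) (sym (Vec.lookup∘tabulate f i)) (sym (Vec.lookup∘tabulate f j))))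

  module IsoMaps {G H : Graph k} (G≅H : Iso G H) where

    to : Fin k → Fin k
    to = lookup (proj₁ G≅H)

    to-injective : Injective _≡_ _≡_ to
    to-injective = proj₁ (proj₂ G≅H) _ _

    adj-to : ∀ i j → adj G i j ≡ adj H (to i) (to j)
    adj-to = proj₂ (proj₂ G≅H)

    from : Fin k → Fin k
    from y = proj₁ (injective⇒surjective to-injective y)

    to-from : ∀ y → to (from y) ≡ y
    to-from y = proj₂ (injective⇒surjective to-injective y)

    from-to : ∀ x → from (to x) ≡ x
    from-to x = to-injective (to-from (to x))

  Iso-sym : {G H : Graph k} → Iso G H → Iso H G
  Iso-sym {G} {H} G≅H = mkIso {H} {G} from (λ eq → ≡.trans (sym (to-from _)) (≡.trans (cong to eq) (to-from _)))
    (λ i j → ≡.trans (cong₂ (adj H) (sym (to-from i)) (sym (to-from j))) (sym (adj-to (from i) (from j))))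
    where open IsoMaps {G = G} {H = H} G≅H

  Iso-trans : {G H K : Graph k} → Iso G H → Iso H K → Iso G K
  Iso-trans {G} {H} {K} G≅H H≅K = mkIso {G} {K} (H→K.to ∘ G→H.to) (G→H.to-injective ∘ H→K.to-injective)
    (λ i j → ≡.trans (G→H.adj-to i j) (H→K.adj-to _ _))
    where module G→H = IsoMaps {G = G} {H = H} G≅H
          module H→K = IsoMaps {G = H} {H = K} H≅K

  Iso-reflexive : {G H : Graph k} → proj₁ G ≡ proj₁ H → Iso G H
  Iso-reflexive {G} {H} G≡H = mkIso {G} {H} id id λ i j → cong (λ A → entry A i j) G≡H

bit : Bool → ℕ
bit b = if b then 1 else 0

length-filter-true : {A : Set} (f : A → Bool) (xs : List A) →
                     length (filter (λ x → f x ≟B true) xs) ≡ ℕ∑.∑ xs (bit ∘ f)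
length-filter-true f []       = ≡.refl
length-filter-true f (x ∷ xs) with f x
... | true  = cong suc (length-filter-true f xs)
... | false = length-filter-true f xs

module _ {k : ℕ} where

  edgeCount : Matrix k → ℕ
  edgeCount A = length (filter (λ p → entry A (proj₁ p) (proj₂ p) ≟B true) (ltPairs k))

  edgeBit : Matrix k → Fin k × Fin k → ℕ
  edgeBit A = bit ∘ uncurry (entry A)

  edgeCount-∑ : (A : Matrix k) → edgeCount A ≡ ℕ∑.∑ (ltPairs k) (edgeBit A)
  edgeCount-∑ A = length-filter-true (uncurry (entry A)) (ltPairs k)

  handshake : (G : Graph k) → ℕ∑.∑ pairs (edgeBit (proj₁ G)) ≡ 2 ℕ.* #E G
  handshake G@(A , symmetric , irreflexive) = begin
    ℕ∑.∑ pairs (edgeBit A)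
      ≡⟨ ℕ∑.∑-cong pairs (λ {p} _ → split p) ⟩
    ℕ∑.∑ pairs (λ p → below p ℕ.+ below (Product.swap p))
      ≡⟨ ℕ∑.∑-distrib pairs below (below ∘ Product.swap) ⟩
    ℕ∑.∑ pairs below ℕ.+ ℕ∑.∑ pairs (below ∘ Product.swap)
      ≡⟨ cong (ℕ∑.∑ pairs below ℕ.+_)
              (ℕ∑.∑-reindex pairs below Product.swap Product.swap (λ _ → ≡.refl) (λ _ → ≡.refl) pairs-unique ∈-pairs) ⟩
    ℕ∑.∑ pairs below ℕ.+ ℕ∑.∑ pairs below
      ≡⟨ cong (λ n → n ℕ.+ n) (sym #E≡∑below) ⟩
    #E G ℕ.+ #E G
      ≡⟨ cong (#E G ℕ.+_) (sym (ℕ.+-identityʳ (#E G))) ⟩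
    2 ℕ.* #E G
      ∎
    where
    open ≡-Reasoning
    below : Fin k × Fin k → ℕ
    below p = ℕ∑.when (does (toℕ (proj₁ p) <? toℕ (proj₂ p))) (edgeBit A p)
    #E≡∑below : #E G ≡ ℕ∑.∑ pairs below
    #E≡∑below = ≡.trans (edgeCount-∑ A) (ℕ∑.∑-filter (λ p → toℕ (proj₁ p) <? toℕ (proj₂ p)) pairs (edgeBit A))
    split : (p : Fin k × Fin k) → edgeBit A p ≡ below p ℕ.+ below (Product.swap p)
    split (i , j) with Fin.<-cmp i j
    ... | tri< i<j _ j≮i rewrite dec-true (toℕ i <? toℕ j) i<j | dec-false (toℕ j <? toℕ i) j≮i =
      sym (ℕ.+-identityʳ _)
    ... | tri> i≮j _ j<i rewrite dec-false (toℕ i <? toℕ j) i≮j | dec-true (toℕ j <? toℕ i) j<i =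
      cong bit (symmetric i j)
    ... | tri≈ i≮j ≡.refl _ rewrite dec-false (toℕ i <? toℕ i) i≮j = cong bit (irreflexive i)

  -- Relabelling does not preserve the order i < j in ltPairs, so compare ordered pairs instead.
  #E-Iso : {G H : Graph k} → Iso G H → #E G ≡ #E H
  #E-Iso {G} {H} G≅H = ℕ.*-cancelˡ-≡ (#E G) (#E H) 2 (begin
    2 ℕ.* #E G
      ≡⟨ sym (handshake G) ⟩
    ℕ∑.∑ pairs (edgeBit (proj₁ G))
      ≡⟨ ℕ∑.∑-cong pairs (λ {(i , j)} _ → cong bit (adj-to i j)) ⟩
    ℕ∑.∑ pairs (edgeBit (proj₁ H) ∘ Product.map to to)
      ≡⟨ ℕ∑.∑-reindex pairs (edgeBit (proj₁ H)) (Product.map to to) (Product.map from from)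
                      (λ (i , j) → cong₂ _,_ (to-from i) (to-from j)) (λ (i , j) → cong₂ _,_ (from-to i) (from-to j))
                      pairs-unique ∈-pairs ⟩
    ℕ∑.∑ pairs (edgeBit (proj₁ H))
      ≡⟨ handshake H ⟩
    2 ℕ.* #E H
      ∎)
    where
    open ≡-Reasoning
    open IsoMaps {G = G} {H = H} G≅H

module _ {k : ℕ} where

  -- Unfolding the definitions, A ⊆M proj₁ G is A ⊆G G and A ⊆M? proj₁ G is ⊆G? A G.
  _⊆M_ : Matrix k → Matrix k → Set
  A ⊆M B = ∀ i j → entry A i j ≡ true → entry B i j ≡ true

  _⊆M?_ : (A B : Matrix k) → Dec (A ⊆M B)
  A ⊆M? B = all? (λ i → all? (λ j → (entry A i j ≟B true) →-dec (entry B i j ≟B true)))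

  extend : (Graph k → ℚ) → Matrix k → ℚ
  extend h A with isGraph? A
  ... | yes A-graph = h (A , A-graph)
  ... | no  _       = 0ℚ

  extend-cong : (h h′ : Graph k → ℚ) {A B : Matrix k} → (IsGraph A → IsGraph B) → (IsGraph B → IsGraph A) →
                (∀ p q → h (A , p) ≡ h′ (B , q)) → extend h A ≡ extend h′ B
  extend-cong h h′ {A} {B} A⇒B B⇒A h≡h′ with isGraph? A | isGraph? B
  ... | yes p | yes q = h≡h′ p q
  ... | yes p | no ¬q = contradiction (A⇒B p) ¬q
  ... | no ¬p | yes q = contradiction (B⇒A q) ¬p
  ... | no _  | no _  = ≡.refl

  extend-graph : {h : Graph k → ℚ} → IsoInvariant h → (G : Graph k) → extend h (proj₁ G) ≡ h G
  extend-graph {h} h-invariant G with isGraph? (proj₁ G)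
  ... | yes p = h-invariant _ G (Iso-reflexive {G = proj₁ G , p} {H = G} ≡.refl)
  ... | no ¬p = contradiction (proj₂ G) ¬p

  extend-congʳ : {h h′ : Graph k → ℚ} → (∀ S → h S ≡ h′ S) → (A : Matrix k) → extend h A ≡ extend h′ A
  extend-congʳ h≗h′ A with isGraph? A
  ... | yes p = h≗h′ (A , p)
  ... | no  _ = ≡.refl

  extend-neg : (h : Graph k → ℚ) (A : Matrix k) → extend (λ S → - h S) A ≡ - extend h A
  extend-neg h A with isGraph? A
  ... | yes _ = ≡.refl
  ... | no  _ = ≡.refl

  extend-∑ : {I : Set} (xs : List I) (h : Graph k → I → ℚ) (A : Matrix k) →
             extend (λ S → ∑ xs (h S)) A ≡ ∑ xs (λ x → extend (λ S → h S x) A)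
  extend-∑ xs h A with isGraph? A
  ... | yes _ = ≡.refl
  ... | no  _ = sym (∑-zero xs λ _ → ≡.refl)

  ∑-subgraphs : (G : Graph k) (h : Graph k → ℚ) →
                ∑ (subgraphs G) h ≡ ∑ (allMatrices k) (λ A → when (does (A ⊆M? proj₁ G)) (extend h A))
  ∑-subgraphs G h = go (allMatrices k)
    where
    go : (As : List (Matrix k)) → ∑ (subgraphsFrom G As) h ≡ ∑ As (λ A → when (does (A ⊆M? proj₁ G)) (extend h A))
    go []       = ≡.refl
    -- `with` cannot abstract the already normalised `does (A ⊆M? proj₁ G)` in the goal.
    go (A ∷ As) with isGraph? A | ⊆G? A G
    ... | yes _ | yes A⊆G = cong₂ _+_ (cong (λ b → when b _) (sym (dec-true (A ⊆M? proj₁ G) A⊆G))) (go As)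
    ... | yes _ | no  A⊈G = ≡.trans (go As) (sym (≡.trans (cong (λ b → when b _ + _) (dec-false (A ⊆M? proj₁ G) A⊈G))
                                                         (ℚ.+-identityˡ _)))
    ... | no  _ | _       = ≡.trans (go As) (sym (≡.trans (cong (_+ _) (when-ε (does (A ⊆M? proj₁ G))))
                                                         (ℚ.+-identityˡ _)))

  ∑-subgraphs-Iso : {h : Graph k → ℚ} → IsoInvariant h → {G H : Graph k} → Iso G H →
                    ∑ (subgraphs G) h ≡ ∑ (subgraphs H) h
  ∑-subgraphs-Iso {h} h-invariant {G} {H} G≅H = begin
    ∑ (subgraphs G) h                     ≡⟨ ∑-subgraphs G h ⟩
    ∑ (allMatrices k) (term G)            ≡⟨ sym (∑-reindex (allMatrices k) (term G) (pull to) (pull from)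
                                                (pull-inverse from-to) (pull-inverse to-from)
                                                (allMatrices-unique k) ∈-allMatrices) ⟩
    ∑ (allMatrices k) (term G ∘ pull to)  ≡⟨ ∑-cong (allMatrices k) (λ {A} _ → term-pull A) ⟩
    ∑ (allMatrices k) (term H)            ≡⟨ sym (∑-subgraphs H h) ⟩
    ∑ (subgraphs H) h                     ∎
    where
    open ≡-Reasoning
    open IsoMaps {G = G} {H = H} G≅H
    term : Graph k → Matrix k → ℚ
    term X A = when (does (A ⊆M? proj₁ X)) (extend h A)
    pull⊆G⇒⊆H : (A : Matrix k) → pull to A ⊆M proj₁ G → A ⊆M proj₁ H
    pull⊆G⇒⊆H A sub x y A-xy = ≡.subst₂ (λ a b → adj H a b ≡ true) (to-from x) (to-from y)
      (≡.trans (sym (adj-to (from x) (from y))) (sub (from x) (from y) pull-from-xy))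
      where
      pull-from-xy : entry (pull to A) (from x) (from y) ≡ true
      pull-from-xy = ≡.trans (entry-pull to A (from x) (from y))
                             (≡.subst₂ (λ a b → entry A a b ≡ true) (sym (to-from x)) (sym (to-from y)) A-xy)
    ⊆H⇒pull⊆G : (A : Matrix k) → A ⊆M proj₁ H → pull to A ⊆M proj₁ G
    ⊆H⇒pull⊆G A sub i j pull-ij = ≡.trans (adj-to i j) (sub (to i) (to j) (≡.trans (sym (entry-pull to A i j)) pull-ij))
    term-pull : (A : Matrix k) → term G (pull to A) ≡ term H A
    term-pull A = cong₂ when (does-⇔ (mk⇔ (pull⊆G⇒⊆H A) (⊆H⇒pull⊆G A)) (pull to A ⊆M? proj₁ G) (A ⊆M? proj₁ H))
      (extend-cong h h (≡.subst IsGraph (pull-inverse to-from A) ∘ IsGraph-pull from (pull to A)) (IsGraph-pull to A)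
         (λ p q → h-invariant _ _ (mkIso {G = pull to A , p} {H = A , q} to to-injective (entry-pull to A))))

  IsoInvariant-* : {f g : Graph k → ℚ} → IsoInvariant f → IsoInvariant g → IsoInvariant (λ S → f S * g S)
  IsoInvariant-* f-invariant g-invariant S H S≅H = cong₂ _*_ (f-invariant S H S≅H) (g-invariant S H S≅H)

  sign∘#E-invariant : IsoInvariant (sign ∘ #E {k})
  sign∘#E-invariant S H S≅H = cong sign (#E-Iso {G = S} {H = H} S≅H)

  ae-invariant : {Φ : Graph k → ℚ} → IsoInvariant Φ → IsoInvariant (ae Φ)
  ae-invariant Φ-invariant S H = ∑-subgraphs-Iso (IsoInvariant-* Φ-invariant sign∘#E-invariant)

-- Möbius inversion over edge sets

module _ {k : ℕ} where

  ⊆M-trans : {A B C : Matrix k} → A ⊆M B → B ⊆M C → A ⊆M C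
  ⊆M-trans A⊆B B⊆C i j = B⊆C i j ∘ A⊆B i j

  ⊆M-antisym : {A B : Matrix k} → A ⊆M B → B ⊆M A → A ≡ B
  ⊆M-antisym {A} {B} A⊆B B⊆A = matrix-ext λ i j → same (entry A i j) (entry B i j) (A⊆B i j) (B⊆A i j)
    where
    same : ∀ x y → (x ≡ true → y ≡ true) → (y ≡ true → x ≡ true) → x ≡ y
    same true  y     x⇒y _   = sym (x⇒y ≡.refl)
    same false true  _   y⇒x = y⇒x ≡.refl
    same false false _   _   = ≡.refl

  missingEdge : {B G : Matrix k} → IsGraph B → IsGraph G → B ⊆M G → B ≢ G →
                ∃₂ λ a b → a < b × entry G a b ≡ true × entry B a b ≡ false
  missingEdge {B} {G} (B-symmetric , _) (G-symmetric , G-irreflexive) B⊆G B≢G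
    with any? (λ i → any? (λ j → (entry G i j ≟B true) ×-dec (entry B i j ≟B false)))
  ... | no none = contradiction (⊆M-antisym B⊆G G⊆B) B≢G
    where
    G⊆B : G ⊆M B
    G⊆B i j Gij with entry B i j in Bij
    ... | true  = ≡.refl
    ... | false = contradiction (i , j , Gij , Bij) none
  ... | yes (i , j , Gij , Bij) with Fin.<-cmp i j
  ... | tri< i<j _ _ = i , j , i<j , Gij , Bij
  ... | tri> _ _ j<i = j , i , j<i , ≡.trans (G-symmetric j i) Gij , ≡.trans (B-symmetric j i) Bij
  ... | tri≈ _ ≡.refl _ = contradiction (≡.trans (sym Gij) (G-irreflexive i)) λ ()

  between? : (B A G : Matrix k) → Dec (B ⊆M A × A ⊆M G)
  between? B A G = B ⊆M? A ×-dec A ⊆M? G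

  signedInterval : Matrix k → Matrix k → ℚ
  signedInterval B G = ∑ (allMatrices k) (λ A → when (does (between? B A G)) (extend (sign ∘ #E) A))

module Toggle {k : ℕ} {a b : Fin k} (a<b : a < b) where

  _≟²_ : DecidableEquality (Fin k × Fin k)
  _≟²_ = Product.≡-dec Fin._≟_ Fin._≟_

  IsAB : Fin k → Fin k → Set
  IsAB i j = (i , j) ≡ (a , b) ⊎ (j , i) ≡ (a , b)

  isAB? : ∀ i j → Dec (IsAB i j)
  isAB? i j = ((i , j) ≟² (a , b)) ⊎-dec ((j , i) ≟² (a , b))

  toggle : Matrix k → Matrix k
  toggle A = matrix (λ i j → does (isAB? i j) xor entry A i j)

  entry-toggle : ∀ A i j → entry (toggle A) i j ≡ does (isAB? i j) xor entry A i j
  entry-toggle A = entry-matrix _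

  entry-toggle-ab : ∀ A → entry (toggle A) a b ≡ not (entry A a b)
  entry-toggle-ab A = ≡.trans (entry-toggle A a b) (cong (_xor entry A a b) (dec-true (isAB? a b) (inj₁ ≡.refl)))

  entry-toggle-other : ∀ A {i j} → ¬ IsAB i j → entry (toggle A) i j ≡ entry A i j
  entry-toggle-other A {i} {j} ¬ab = ≡.trans (entry-toggle A i j) (cong (_xor entry A i j) (dec-false (isAB? i j) ¬ab))

  toggle-involutive : ∀ A → toggle (toggle A) ≡ A
  toggle-involutive A = matrix-ext λ i j → let e = does (isAB? i j) in begin
    entry (toggle (toggle A)) i j    ≡⟨ entry-toggle (toggle A) i j ⟩
    e xor entry (toggle A) i j       ≡⟨ cong (e xor_) (entry-toggle A i j) ⟩
    e xor (e xor entry A i j)        ≡⟨ sym (xor-assoc e e (entry A i j)) ⟩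
    (e xor e) xor entry A i j        ≡⟨ cong (_xor entry A i j) (xor-same e) ⟩
    entry A i j                      ∎
    where open ≡-Reasoning

  IsGraph-toggle : ∀ A → IsGraph A → IsGraph (toggle A)
  IsGraph-toggle A (symmetric , irreflexive) =
    (λ i j → ≡.trans (entry-toggle A i j) (≡.trans (cong₂ _xor_ (does-⇔ (mk⇔ Sum.swap Sum.swap) (isAB? i j) (isAB? j i))
                                                             (symmetric i j))
                                                   (sym (entry-toggle A j i)))) ,
    (λ i → ≡.trans (entry-toggle-other A λ { (inj₁ ≡.refl) → Fin.<-irrefl ≡.refl a<b
                                            ; (inj₂ ≡.refl) → Fin.<-irrefl ≡.refl a<b }) (irreflexive i))

  toggle-⊆ : ∀ A G → IsGraph G → entry G a b ≡ true → A ⊆M G → toggle A ⊆M G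
  toggle-⊆ A G (G-symmetric , _) Gab A⊆G i j tAij with isAB? i j
  ... | yes (inj₁ ≡.refl) = Gab
  ... | yes (inj₂ ≡.refl) = ≡.trans (G-symmetric b a) Gab
  ... | no  ¬ab           = A⊆G i j (≡.trans (sym (entry-toggle-other A ¬ab)) tAij)

  ⊆-toggle : ∀ B A → IsGraph B → entry B a b ≡ false → B ⊆M A → B ⊆M toggle A
  ⊆-toggle B A (B-symmetric , _) Bab B⊆A i j Bij with isAB? i j
  ... | yes (inj₁ ≡.refl) = contradiction (≡.trans (sym Bij) Bab) λ ()
  ... | yes (inj₂ ≡.refl) = contradiction (≡.trans (sym Bij) (≡.trans (B-symmetric b a) Bab)) λ ()
  ... | no  ¬ab           = ≡.trans (entry-toggle-other A ¬ab) (B⊆A i j Bij)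

  edgeCount-toggle : ∀ A → entry A a b ≡ false → edgeCount (toggle A) ≡ suc (edgeCount A)
  edgeCount-toggle A Aab = begin
    edgeCount (toggle A)
      ≡⟨ edgeCount-∑ (toggle A) ⟩
    ℕ∑.∑ (ltPairs k) (edgeBit (toggle A))
      ≡⟨ ℕ∑.∑-change-at (ltPairs k) (edgeBit A) (edgeBit (toggle A))
                        (Unique.filter⁺ _ pairs-unique) ab∈ltPairs (cong bit Aab) unchanged ⟩
    edgeBit (toggle A) (a , b) ℕ.+ ℕ∑.∑ (ltPairs k) (edgeBit A)
      ≡⟨ cong (λ x → bit x ℕ.+ _) (≡.trans (entry-toggle-ab A) (cong not Aab)) ⟩
    suc (ℕ∑.∑ (ltPairs k) (edgeBit A))
      ≡⟨ cong suc (sym (edgeCount-∑ A)) ⟩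
    suc (edgeCount A)
      ∎
    where
    open ≡-Reasoning
    ab∈ltPairs : (a , b) ∈ ltPairs k
    ab∈ltPairs = ∈-filter⁺ (λ p → toℕ (proj₁ p) <? toℕ (proj₂ p)) (∈-pairs (a , b)) a<b
    unchanged : ∀ {p} → p ∈ ltPairs k → p ≢ (a , b) → edgeBit (toggle A) p ≡ edgeBit A p
    unchanged {i , j} p∈ltPairs p≢ab = cong bit (entry-toggle-other A λ
      { (inj₁ ij≡ab)  → p≢ab ij≡ab
      ; (inj₂ ≡.refl) → Fin.<-asym a<b (proj₂ (∈-filter⁻ (λ p → toℕ (proj₁ p) <? toℕ (proj₂ p)) {xs = pairs} p∈ltPairs)) })

  sign-toggle : ∀ A → sign (edgeCount (toggle A)) ≡ - sign (edgeCount A)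
  sign-toggle A with entry A a b in Aab
  ... | false = cong sign (edgeCount-toggle A Aab)
  ... | true  = begin
    sign (edgeCount (toggle A))               ≡⟨ sym (-‿involutive _) ⟩
    - sign (suc (edgeCount (toggle A)))       ≡⟨ cong (-_ ∘ sign) (sym (edgeCount-toggle (toggle A) tAab)) ⟩
    - sign (edgeCount (toggle (toggle A)))    ≡⟨ cong (-_ ∘ sign ∘ edgeCount) (toggle-involutive A) ⟩
    - sign (edgeCount A)                      ∎
    where
    open ≡-Reasoning
    tAab : entry (toggle A) a b ≡ false
    tAab = ≡.trans (entry-toggle-ab A) (cong not Aab)

  signedInterval-missingEdge : {B G : Matrix k} → IsGraph B → IsGraph G → entry G a b ≡ true → entry B a b ≡ false →
                               signedInterval B G ≡ 0ℚ
  signedInterval-missingEdge {B} {G} B-graph G-graph Gab Bab = x≡-x⇒x≡0 _ (begin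
    signedInterval B G
      ≡⟨ sym (∑-reindex (allMatrices k) term toggle toggle toggle-involutive toggle-involutive
                        (allMatrices-unique k) ∈-allMatrices) ⟩
    ∑ (allMatrices k) (term ∘ toggle)
      ≡⟨ ∑-cong (allMatrices k) (λ {A} _ → term-toggle A) ⟩
    ∑ (allMatrices k) (λ A → - term A)
      ≡⟨ sym (∑-neg (allMatrices k) term) ⟩
    - signedInterval B G
      ∎)
    where
    open ≡-Reasoning
    term : Matrix k → ℚ
    term A = when (does (between? B A G)) (extend (sign ∘ #E) A)
    between-toggle : ∀ A → (B ⊆M toggle A × toggle A ⊆M G) ⇔ (B ⊆M A × A ⊆M G)
    between-toggle A = mk⇔
      (λ (B⊆tA , tA⊆G) → ≡.subst (B ⊆M_) (toggle-involutive A) (⊆-toggle B (toggle A) B-graph Bab B⊆tA) ,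
                         ≡.subst (_⊆M G) (toggle-involutive A) (toggle-⊆ (toggle A) G G-graph Gab tA⊆G))
      (λ (B⊆A , A⊆G) → ⊆-toggle B A B-graph Bab B⊆A , toggle-⊆ A G G-graph Gab A⊆G)
    extend-toggle : ∀ A → extend (sign ∘ #E) (toggle A) ≡ - extend (sign ∘ #E) A
    extend-toggle A = ≡.trans
      (extend-cong (sign ∘ #E) (λ S → - sign (#E S))
        (≡.subst IsGraph (toggle-involutive A) ∘ IsGraph-toggle (toggle A)) (IsGraph-toggle A) (λ _ _ → sign-toggle A))
      (extend-neg (sign ∘ #E) A)
    term-toggle : ∀ A → term (toggle A) ≡ - term A
    term-toggle A = ≡.trans
      (cong₂ when (does-⇔ (between-toggle A) (between? B (toggle A) G) (between? B A G)) (extend-toggle A))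
      (when-neg (does (between? B A G)) _)

module _ {k : ℕ} where

  signedInterval-refl : (G : Graph k) → signedInterval (proj₁ G) (proj₁ G) ≡ sign (#E G)
  signedInterval-refl G@(G′ , _) = begin
    signedInterval G′ G′
      ≡⟨ ∑-delta (allMatrices k) term (allMatrices-unique k) (∈-allMatrices G′) off-diagonal ⟩
    term G′
      ≡⟨ cong (λ c → when c (extend (sign ∘ #E) G′)) (dec-true (between? G′ G′ G′) ((λ _ _ → id) , (λ _ _ → id))) ⟩
    extend (sign ∘ #E) G′
      ≡⟨ extend-graph sign∘#E-invariant G ⟩
    sign (#E G)
      ∎
    where
    open ≡-Reasoning
    term : Matrix k → ℚ
    term A = when (does (between? G′ A G′)) (extend (sign ∘ #E) A)
    off-diagonal : ∀ {A} → A ∈ allMatrices k → A ≢ G′ → term A ≡ 0ℚ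
    off-diagonal {A} _ A≢G = cong (λ c → when c _)
      (dec-false (between? G′ A G′) λ (G⊆A , A⊆G) → A≢G (⊆M-antisym A⊆G G⊆A))

  signedInterval-≢ : {B G : Matrix k} → IsGraph B → IsGraph G → B ≢ G → signedInterval B G ≡ 0ℚ
  signedInterval-≢ {B} {G} B-graph G-graph B≢G with B ⊆M? G
  ... | no B⊈G = ∑-zero (allMatrices k) λ {A} _ → cong (λ c → when c _)
    (dec-false (between? B A G) λ (B⊆A , A⊆G) → B⊈G (⊆M-trans {A = B} {B = A} {C = G} B⊆A A⊆G))
  ... | yes B⊆G =
    let a , b , a<b , Gab , Bab = missingEdge B-graph G-graph B⊆G B≢G
    in Toggle.signedInterval-missingEdge a<b {B = B} {G = G} B-graph G-graph Gab Bab

  extend-*-signedInterval-≢ : (h : Graph k → ℚ) {B G : Matrix k} → IsGraph G → B ≢ G →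
                              extend h B * signedInterval B G ≡ 0ℚ
  extend-*-signedInterval-≢ h {B} {G} G-graph B≢G with isGraph? B
  ... | yes B-graph = ≡.trans (cong (h (B , B-graph) *_) (signedInterval-≢ {B = B} {G = G} B-graph G-graph B≢G))
                              (ℚ.*-zeroʳ (h (B , B-graph)))
  ... | no  _       = ℚ.*-zeroˡ (signedInterval B G)

  ∑-subgraphs-möbius : (G : Graph k) (h : Graph k → ℚ) →
    ∑ (subgraphs G) (λ S → sign (#E S) * ∑ (subgraphs S) h) ≡ extend h (proj₁ G) * sign (#E G)
  ∑-subgraphs-möbius G@(G′ , G-graph) h = begin
    ∑ (subgraphs G) (λ S → sign (#E S) * ∑ (subgraphs S) h)
      ≡⟨ ∑-subgraphs G _ ⟩
    ∑ M (λ A → when (does (A ⊆M? G′)) (extend (λ S → sign (#E S) * ∑ (subgraphs S) h) A))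
      ≡⟨ ∑-cong M (λ {A} _ → expand A) ⟩
    ∑ M (λ A → ∑ M (term A))
      ≡⟨ ∑-comm M M term ⟩
    ∑ M (λ B → ∑ M (λ A → term A B))
      ≡⟨ ∑-cong M (λ {B} _ → ≡.trans (∑-cong M (λ {A} _ → term≡ A B)) (sym (∑-*ˡ (extend h B) M _))) ⟩
    ∑ M (λ B → extend h B * signedInterval B G′)
      ≡⟨ ∑-delta M _ (allMatrices-unique k) (∈-allMatrices G′) (λ {B} _ → extend-*-signedInterval-≢ h G-graph) ⟩
    extend h G′ * signedInterval G′ G′
      ≡⟨ cong (extend h G′ *_) (signedInterval-refl G) ⟩
    extend h G′ * sign (#E G)
      ∎
    where
    open ≡-Reasoning
    M : List (Matrix k)
    M = allMatrices k
    term : Matrix k → Matrix k → ℚ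
    term A B = when (does (A ⊆M? G′)) (extend (λ S → sign (#E S) * when (does (B ⊆M? proj₁ S)) (extend h B)) A)
    expand : ∀ A → when (does (A ⊆M? G′)) (extend (λ S → sign (#E S) * ∑ (subgraphs S) h) A) ≡ ∑ M (term A)
    expand A = ≡.trans
      (cong (when (does (A ⊆M? G′)))
        (≡.trans (extend-congʳ (λ S → ≡.trans (cong (sign (#E S) *_) (∑-subgraphs S h)) (∑-*ˡ (sign (#E S)) M _)) A)
                 (extend-∑ M _ A)))
      (when-∑ (does (A ⊆M? G′)) M _)
    term≡ : ∀ A B → term A B ≡ extend h B * when (does (between? B A G′)) (extend (sign ∘ #E) A)
    term≡ A B with isGraph? A
    ... | yes _ = when-*-when (does (B ⊆M? A)) (does (A ⊆M? G′)) (sign (edgeCount A)) (extend h B)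
    ... | no  _ = ≡.trans (when-ε (does (A ⊆M? G′)))
                          (sym (≡.trans (cong (extend h B *_) (when-ε (does (between? B A G′)))) (ℚ.*-zeroʳ (extend h B))))

-- Grouping subgraphs by isomorphism class

module _ {k : ℕ} {f : Graph k → ℚ} (f-invariant : IsoInvariant f) where

  ∑-isoClass : (S : Graph k) (Hs : List (Graph k)) → Any (Iso S) Hs → AllPairs (λ H H′ → ¬ Iso H H′) Hs →
               ∑ Hs (λ H → when (does (iso? S H)) (f H)) ≡ f S
  ∑-isoClass S (H ∷ Hs) (here S≅H) (H≇Hs ∷ _) = begin
    when (does (iso? S H)) (f H) + ∑ Hs (λ H′ → when (does (iso? S H′)) (f H′))
      ≡⟨ cong₂ _+_ (cong (λ c → when c (f H)) (dec-true (iso? S H) S≅H)) (∑-zero Hs λ {H′} H′∈Hs →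
           cong (λ c → when c (f H′)) (dec-false (iso? S H′) λ S≅H′ →
             All.lookup H≇Hs H′∈Hs (Iso-trans {G = H} {H = S} {K = H′} (Iso-sym {G = S} {H = H} S≅H) S≅H′))) ⟩
    f H + 0ℚ
      ≡⟨ ℚ.+-identityʳ (f H) ⟩
    f H
      ≡⟨ sym (f-invariant S H S≅H) ⟩
    f S
      ∎
    where open ≡-Reasoning
  ∑-isoClass S (H ∷ Hs) (there S≅Hs) (H≇Hs ∷ Hs-distinct) = begin
    when (does (iso? S H)) (f H) + ∑ Hs (λ H′ → when (does (iso? S H′)) (f H′))
      ≡⟨ cong (λ c → when c (f H) + _) (dec-false (iso? S H) S≇H) ⟩
    0ℚ + ∑ Hs (λ H′ → when (does (iso? S H′)) (f H′))
      ≡⟨ ℚ.+-identityˡ _ ⟩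
    ∑ Hs (λ H′ → when (does (iso? S H′)) (f H′))
      ≡⟨ ∑-isoClass S Hs S≅Hs Hs-distinct ⟩
    f S
      ∎
    where
    open ≡-Reasoning
    S≇H : ¬ Iso S H
    S≇H S≅H = let H≇H′ , S≅H′ = All.lookupAny H≇Hs S≅Hs
              in H≇H′ (Iso-trans {G = H} {H = S} {K = Any.lookup S≅Hs} (Iso-sym {G = S} {H = H} S≅H) S≅H′)

  ∑-representatives : (𝒢* : List (Graph k)) → IsRepSystem 𝒢* → (Ss : List (Graph k)) →
                      ∑ 𝒢* (λ H → f H * ℕtoℚ (length (filter (λ S → iso? S H) Ss))) ≡ ∑ Ss f
  ∑-representatives 𝒢* (covers , distinct) Ss = begin
    ∑ 𝒢* (λ H → f H * ℕtoℚ (length (filter (λ S → iso? S H) Ss)))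
      ≡⟨ ∑-cong 𝒢* (λ {H} _ → *-ℕtoℚ-count (λ S → iso? S H) (f H) Ss) ⟩
    ∑ 𝒢* (λ H → ∑ Ss (λ S → when (does (iso? S H)) (f H)))
      ≡⟨ ∑-comm 𝒢* Ss (λ H S → when (does (iso? S H)) (f H)) ⟩
    ∑ Ss (λ S → ∑ 𝒢* (λ H → when (does (iso? S H)) (f H)))
      ≡⟨ ∑-cong Ss (λ {S} _ → ∑-isoClass S 𝒢* (covers S) distinct) ⟩
    ∑ Ss f
      ∎
    where open ≡-Reasoning

theorem5p1 : (k : ℕ) (Φ : Graph k → ℚ) → IsoInvariant Φ →
    (𝒢* : List (Graph k)) → IsRepSystem 𝒢* →
    Σ (Graph k → ℚ) λ a →
    (∀ (G : Graph k) → Φ G ≡ sumℚ (map (λ H → a H * ℕtoℚ (#Sub H G)) 𝒢*)) ×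
    All (λ H → a H ≡ sign (#E H) * ae Φ H) 𝒢*
theorem5p1 k Φ Φ-invariant 𝒢* 𝒢*-reps = a , expansion , All.tabulate λ _ → ≡.refl
  where
  a : Graph k → ℚ
  a H = sign (#E H) * ae Φ H
  expansion : ∀ G → Φ G ≡ ∑ 𝒢* (λ H → a H * ℕtoℚ (#Sub H G))
  expansion G = sym (begin
    ∑ 𝒢* (λ H → a H * ℕtoℚ (#Sub H G))
      ≡⟨ ∑-representatives (IsoInvariant-* sign∘#E-invariant (ae-invariant Φ-invariant)) 𝒢* 𝒢*-reps (subgraphs G) ⟩
    ∑ (subgraphs G) a
      ≡⟨ ∑-subgraphs-möbius G (λ T → Φ T * sign (#E T)) ⟩
    extend (λ T → Φ T * sign (#E T)) (proj₁ G) * sign (#E G)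
      ≡⟨ cong (_* sign (#E G)) (extend-graph (IsoInvariant-* Φ-invariant sign∘#E-invariant) G) ⟩
    Φ G * sign (#E G) * sign (#E G)
      ≡⟨ ℚ.*-assoc (Φ G) _ _ ⟩
    Φ G * (sign (#E G) * sign (#E G))
      ≡⟨ cong (Φ G *_) (sign-*-sign (#E G)) ⟩
    Φ G * 1ℚ
      ≡⟨ ℚ.*-identityʳ (Φ G) ⟩
    Φ G
      ∎)
    where open ≡-Reasoning
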